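{- For every set of events $cs$, state predicates $s_1,s_2$, trace expressions $t_1,t_2$, event-set expression $E$ and $\sigma_1:\Sigma\to\Sigma$: $\Phi(s_1,\sigma_1,t_1)\,\mathbf{wr}_{cs}\,\mathcal{I}(s_2,t_2) = \forall tt_0,tt_1\bullet\mathcal{I}(s_1\wedge s_2\wedge tt_1\in(t_2{}^\frown tt_0)\parallel_{cs}t_1\wedge(t_2{}^\frown tt_0)\restriction cs = t_1\restriction cs,\ tt_1)$, and $\mathcal{E}(s_1,t_1,E)\,\mathbf{wr}_{cs}\,\mathcal{I}(s_2,t_2) = \forall tt_0,tt_1\bullet\mathcal{I}(s_1\wedge s_2\wedge tt_1\in(t_2{}^\frown tt_0)\parallel_{cs}t_1\wedge(t_2{}^\frown tt_0)\restriction cs = t_1\restriction cs,\ tt_1)$.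
   Context: UTP setting: relations are predicates over undashed (initial) and dashed (final) variables; $;$ is relational composition; $P\lhd c\rhd Q = (c\wedge P)\vee(\neg c\wedge Q)$. Observational variables: booleans $ok,ok',wait,wait'$; traces $tr,tr'$ (finite event sequences; $\le$ prefix, ${}^\frown$ concatenation, $-$ removal of a prefix); state $st,st'\in\Sigma$; refusal sets $ref,ref'$; $tt$ abbreviates $tr'-tr$. $\mathbf{R1}(P) = P\wedge tr\le tr'$; $\mathbf{R2}(P) = P[\langle\rangle,tr'-tr/tr,tr']\lhd tr\le tr'\rhd P$; $\mathbf{RR}(P) = \exists ok,ok',wait,wait'\bullet\mathbf{R1}(\mathbf{R2}(P))$; $\mathbf{RC}(P) = \mathbf{R1}(\mathbf{RR}(P);(tr'\le tr))$; $\mathbf{CRR}(P)=\exists ref\bullet\mathbf{RR}(P)$; $\mathbf{CRC}(P) = \exists ref\bullet\mathbf{RC}(P)$. $\mathit{true}_r = \mathbf{R1}(\mathit{true})$, $\neg_r P = \mathbf{R1}(\neg P)$, $P\Rightarrow_r Q = \neg_r P\vee Q$. For a state predicate $s$, trace-valued expression $t$, event-set-valued expression $A$ over $st$, and $\sigma:\Sigma\to\Sigma$: $\mathcal{I}(s,t) = \mathbf{CRC}(s\Rightarrow_r\neg_r(t\le tt))$; $\mathcal{E}(s,t,A) = \mathbf{CRR}(s\wedge tt = t\wedge\forall e\in A\bullet e\notin ref')$; $\Phi(s,\sigma,t) = \mathbf{CRR}(s\wedge st'=\sigma(st)\wedge tt=t)$. Lenses: a lens $X:V\Rightarrow\Sigma$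 is a pair $get_X,put_X$ with $get(put\,s\,v)=v$, $put(put\,s\,v')\,v = put\,s\,v$, $put\,s\,(get\,s)=s$; override $s_1\oplus_X s_2 = put_X\,s_1\,(get_X\,s_2)$; $\mathbf{0}$ is the lens with a singleton view ($put\,s\,v=s$). Parallel-by-merge: $P\parallel_M Q = (P_0\wedge Q_1\wedge v'=v);M$, with $v$ the tuple of all variables, $P_0$ ($Q_1$) obtained by renaming each dashed $x'$ of $P$ ($Q$) to $0.x$ ($1.x$), and $M$ relating $x,0.x,1.x$ to $x'$. Trace merge $\parallel_{cs}$: least function from pairs of event sequences to sets of sequences with $\langle\rangle\parallel_{cs}\langle\rangle = \{\langle\rangle\}$; $(e{:}u)\parallel_{cs}\langle\rangle$ and $\langle\rangle\parallel_{cs}(e{:}u)$ equal $\{\langle\rangle\}$ if $e\in cs$, otherwise $\{\langle e\rangle\}{}^\frown(u\parallel_{cs}\langle\rangle)$, resp. $\{\langle e\rangle\}{}^\frown(\langle\rangle\parallel_{cs}u)$; $(e{:}u_1)\parallel_{cs}(e{:}u_2) = \{\langle e\rangle\}{}^\frown(u_1\parallel_{cs}u_2)$ if $e\in cs$, else $\{\langle e\rangle\}{}^\frown(u_1\parallel_{cs}(e{:}u_2)\cup(e{:}u_1)\parallel_{cs}u_2)$; for $e_1\neq e_2$: $\{\langle\rangle\}$ if both in $cs$, $\{\langle e_2\rangle\}{}^\frown((e_1{:}u_1)\parallel_{cs}u_2)$ if only $e_1\in cs$, $\{\langle e_1\rangle\}{}^\frown(u_1\parallel_{cs}(e_2{:}u_2))$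 if only $e_2\in cs$, the union of these two if neither. $S{}^\frown T = \{a{}^\frown b\mid a\in S,b\in T\}$; $u\restriction cs$ is the subsequence of elements of $u$ in $cs$. Merge: $N_I = (tt\in0.tt\parallel_{cs}1.tt\wedge0.tt\restriction cs = 1.tt\restriction cs\wedge ref'\subseteq((0.ref\cup1.ref)\cap cs)\cup((0.ref\cap1.ref)\setminus cs)\wedge st' = (st\oplus_{\mathbf{0}}0.st)\oplus_{\mathbf{0}}1.st)$, with $0.tt = 0.tr - tr$, $1.tt = 1.tr-tr$. Weakest rely: $P\,\mathbf{wr}_{cs}\,Q = \neg_r((\neg_r Q)\parallel_{N_I;\mathit{true}_r}P)$. -}

module Defs where

open import Data.Bool using (Bool; true; false; if_then_else_; _∧_; _∨_; not)
open import Data.List using (List; []; _∷_; _++_; drop; length)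
open import Data.Product using (Σ; ∃; _×_; _,_)
open import Data.Sum using (_⊎_)
open import Data.Unit using (⊤; tt)
open import Relation.Nullary using (¬_)
open import Relation.Binary.PropositionalEquality using (_≡_)

module UTP (E S : Set) where

  ESet : Set
  ESet = E → Bool

  _∈ₑ_ : E → ESet → Set
  e ∈ₑ X = X e ≡ true

  _∉ₑ_ : E → ESet → Set
  e ∉ₑ X = ¬ (e ∈ₑ X)

  _⊆ₑ_ : ESet → ESet → Set
  X ⊆ₑ Y = ∀ e → e ∈ₑ X → e ∈ₑ Y

  _∪ₑ_ _∩ₑ_ _∖ₑ_ : ESet → ESet → ESet
  (X ∪ₑ Y) e = X e ∨ Y e
  (X ∩ₑ Y) e = X e ∧ Y e
  (X ∖ₑ Y) e = X e ∧ not (Y e)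

  Trace : Set
  Trace = List E

  _≼_ : Trace → Trace → Set
  u ≼ w = Σ Trace λ z → w ≡ u ++ z

  -- removal of a prefix: w - u  (only ever meaningful when u ≼ w)
  _-ₜ_ : Trace → Trace → Trace
  w -ₜ u = drop (length u) w

  _↾_ : Trace → ESet → Trace
  [] ↾ cs = []
  (e ∷ u) ↾ cs = if cs e then e ∷ (u ↾ cs) else (u ↾ cs)

  -- Trace merge: w ∈ u₁ ∥[cs] u₂ is membership in the least function
  -- defined by the paper's equations (one constructor per set element).
  data _∈_∥[_]_ : Trace → Trace → ESet → Trace → Set where
    nil     : ∀ {cs} → [] ∈ [] ∥[ cs ] []
    l-sync  : ∀ {cs e u} → e ∈ₑ cs → [] ∈ (e ∷ u) ∥[ cs ] []
    l-async : ∀ {cs e u w} → e ∉ₑ cs → w ∈ u ∥[ cs ] [] →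
              (e ∷ w) ∈ (e ∷ u) ∥[ cs ] []
    r-sync  : ∀ {cs e u} → e ∈ₑ cs → [] ∈ [] ∥[ cs ] (e ∷ u)
    r-async : ∀ {cs e u w} → e ∉ₑ cs → w ∈ [] ∥[ cs ] u →
              (e ∷ w) ∈ [] ∥[ cs ] (e ∷ u)
    eq-sync : ∀ {cs e u₁ u₂ w} → e ∈ₑ cs → w ∈ u₁ ∥[ cs ] u₂ →
              (e ∷ w) ∈ (e ∷ u₁) ∥[ cs ] (e ∷ u₂)
    eq-asyncˡ : ∀ {cs e u₁ u₂ w} → e ∉ₑ cs → w ∈ u₁ ∥[ cs ] (e ∷ u₂) →
              (e ∷ w) ∈ (e ∷ u₁) ∥[ cs ] (e ∷ u₂)
    eq-asyncʳ : ∀ {cs e u₁ u₂ w} → e ∉ₑ cs → w ∈ (e ∷ u₁) ∥[ cs ] u₂ →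
              (e ∷ w) ∈ (e ∷ u₁) ∥[ cs ] (e ∷ u₂)
    ne-sync : ∀ {cs e₁ e₂ u₁ u₂} → ¬ (e₁ ≡ e₂) → e₁ ∈ₑ cs → e₂ ∈ₑ cs →
              [] ∈ (e₁ ∷ u₁) ∥[ cs ] (e₂ ∷ u₂)
    ne-left-cs : ∀ {cs e₁ e₂ u₁ u₂ w} → ¬ (e₁ ≡ e₂) → e₁ ∈ₑ cs → e₂ ∉ₑ cs →
              w ∈ (e₁ ∷ u₁) ∥[ cs ] u₂ →
              (e₂ ∷ w) ∈ (e₁ ∷ u₁) ∥[ cs ] (e₂ ∷ u₂)
    ne-right-cs : ∀ {cs e₁ e₂ u₁ u₂ w} → ¬ (e₁ ≡ e₂) → e₁ ∉ₑ cs → e₂ ∈ₑ cs →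
              w ∈ u₁ ∥[ cs ] (e₂ ∷ u₂) →
              (e₁ ∷ w) ∈ (e₁ ∷ u₁) ∥[ cs ] (e₂ ∷ u₂)
    ne-asyncˡ : ∀ {cs e₁ e₂ u₁ u₂ w} → ¬ (e₁ ≡ e₂) → e₁ ∉ₑ cs → e₂ ∉ₑ cs →
              w ∈ (e₁ ∷ u₁) ∥[ cs ] u₂ →
              (e₂ ∷ w) ∈ (e₁ ∷ u₁) ∥[ cs ] (e₂ ∷ u₂)
    ne-asyncʳ : ∀ {cs e₁ e₂ u₁ u₂ w} → ¬ (e₁ ≡ e₂) → e₁ ∉ₑ cs → e₂ ∉ₑ cs →
              w ∈ u₁ ∥[ cs ] (e₂ ∷ u₂) →
              (e₁ ∷ w) ∈ (e₁ ∷ u₁) ∥[ cs ] (e₂ ∷ u₂)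

  record Lens (V : Set) : Set where
    field
      get     : S → V
      put     : S → V → S
      put-get : ∀ s v → get (put s v) ≡ v
      put-put : ∀ s v v' → put (put s v') v ≡ put s v
      get-put : ∀ s → put s (get s) ≡ s

  open Lens public

  _⊕[_]_ : ∀ {V} → S → Lens V → S → S
  s₁ ⊕[ X ] s₂ = put X s₁ (get X s₂)

  𝟎 : Lens ⊤
  𝟎 = record { get = λ _ → tt ; put = λ s _ → s
             ; put-get = λ _ _ → Relation.Binary.PropositionalEquality.refl
             ; put-put = λ _ _ _ → Relation.Binary.PropositionalEquality.refl
             ; get-put = λ _ → Relation.Binary.PropositionalEquality.refl }

  record Obs : Set where
    constructor obs
    field
      ok   : Bool
      wait : Bool
      tr   : Trace
      st   : S
      ref  : ESet

  open Obs public

  -- a relation: predicate over undashed (first) and dashed (second) variables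
  Rel : Set₁
  Rel = Obs → Obs → Set

  _≈ᵣ_ : Rel → Rel → Set
  P ≈ᵣ Q = ∀ v v' → (P v v' → Q v v') × (Q v v' → P v v')

  _⨾_ : Rel → Rel → Rel
  (P ⨾ Q) v v' = Σ Obs λ w → P v w × Q w v'

  cond : Rel → Rel → Rel → Rel
  cond P c Q v v' = (c v v' × P v v') ⊎ (¬ c v v' × Q v v')

  ttr : Obs → Obs → Trace
  ttr v v' = tr v' -ₜ tr v

  R1 : Rel → Rel
  R1 P v v' = P v v' × (tr v ≼ tr v')

  R2 : Rel → Rel
  R2 P = cond (λ v v' → P (record v { tr = [] }) (record v' { tr = tr v' -ₜ tr v }))
              (λ v v' → tr v ≼ tr v')
              P

  RR : Rel → Rel
  RR P v v' = Σ Bool λ o → Σ Bool λ o' → Σ Bool λ w → Σ Bool λ w' →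
    R1 (R2 P) (record v { ok = o ; wait = w }) (record v' { ok = o' ; wait = w' })

  RC : Rel → Rel
  RC P = R1 (RR P ⨾ (λ v v' → tr v' ≼ tr v))

  CRR : Rel → Rel
  CRR P v v' = Σ ESet λ X → RR P (record v { ref = X }) v'

  CRC : Rel → Rel
  CRC P v v' = Σ ESet λ X → RC P (record v { ref = X }) v'

  true-r : Rel
  true-r = R1 (λ _ _ → ⊤)

  ¬r_ : Rel → Rel
  ¬r P = R1 (λ v v' → ¬ P v v')

  _⇒r_ : Rel → Rel → Rel
  (P ⇒r Q) v v' = (¬r P) v v' ⊎ Q v v'

  𝓘 : (S → Set) → (S → Trace) → Rel
  𝓘 s t = CRC ((λ v v' → s (st v)) ⇒r (¬r (λ v v' → t (st v) ≼ ttr v v')))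

  𝓔 : (S → Set) → (S → Trace) → (S → ESet) → Rel
  𝓔 s t A = CRR (λ v v' → s (st v) × ttr v v' ≡ t (st v)
                         × (∀ e → e ∈ₑ A (st v) → e ∉ₑ ref v'))

  Φ : (S → Set) → (S → S) → (S → Trace) → Rel
  Φ s σ t = CRR (λ v v' → s (st v) × st v' ≡ σ (st v) × ttr v v' ≡ t (st v))

  -- Parallel by merge; merge predicates relate (x, 0.x, 1.x) to x'
  MergeRel : Set₁
  MergeRel = Obs → Obs → Obs → Obs → Set

  _∥[_]ᵐ_ : Rel → MergeRel → Rel → Rel
  (P ∥[ M ]ᵐ Q) v v' = Σ Obs λ v₀ → Σ Obs λ v₁ → P v v₀ × Q v v₁ × M v v₀ v₁ v'

  _⨾ᵐ_ : MergeRel → Rel → MergeRel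
  (M ⨾ᵐ R) v v₀ v₁ v' = Σ Obs λ w → M v v₀ v₁ w × R w v'

  N-I : ESet → MergeRel
  N-I cs v v₀ v₁ v' =
      (ttr v v' ∈ ttr v v₀ ∥[ cs ] ttr v v₁)
    × (ttr v v₀ ↾ cs ≡ ttr v v₁ ↾ cs)
    × (ref v' ⊆ₑ (((ref v₀ ∪ₑ ref v₁) ∩ₑ cs) ∪ₑ ((ref v₀ ∩ₑ ref v₁) ∖ₑ cs)))
    × (st v' ≡ (st v ⊕[ 𝟎 ] st v₀) ⊕[ 𝟎 ] st v₁)

  _wr[_]_ : Rel → ESet → Rel → Rel
  P wr[ cs ] Q = ¬r ((¬r Q) ∥[ N-I cs ⨾ᵐ true-r ]ᵐ P)

  rhs43 : ESet → (S → Set) → (S → Set) → (S → Trace) → (S → Trace) → Rel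
  rhs43 cs s₁ s₂ t₁ t₂ v v' = ∀ (tt₀ tt₁ : Trace) →
    𝓘 (λ σ → s₁ σ × s₂ σ × (tt₁ ∈ (t₂ σ ++ tt₀) ∥[ cs ] t₁ σ)
              × ((t₂ σ ++ tt₀) ↾ cs ≡ t₁ σ ↾ cs))
      (λ _ → tt₁) v v'

-- Both Φ(s₁, σ₁, t₁) and 𝓔(s₁, t₁, E) only start in states satisfying s₁,
-- always emit exactly t₁, and can do so whenever s₁ holds; nothing else about
-- them matters. Classically, ¬ᵣ 𝓘(s₂, t₂) emits, under s₂, exactly the
-- extensions t₂ ⁀ tt₀ of t₂. Since the merge is followed by true_r, the
-- parallel composition inside the weakest rely reaches a trace iff that trace
-- extends some cs-merge tt₁ of t₂ ⁀ tt₀ with t₁ on which both agree on cs,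
-- and these are exactly the prefixes the right-hand side forbids.
module Submission where

open import Defs
open import Data.List using (List; []; _∷_; _++_; drop; length)
open import Data.List.Properties using (++-assoc; ++-identityʳ)
open import Data.Bool using (Bool; false)
open import Data.Nat using (zero; suc)
open import Data.Product using (Σ; _×_; _,_; proj₁; proj₂)
open import Data.Sum using (_⊎_; inj₁; inj₂; [_,_]′; map)
open import Data.Empty using (⊥-elim)
open import Relation.Nullary using (¬_; yes; no)
open import Relation.Binary.PropositionalEquality using (_≡_; refl; sym; trans; cong; subst)
open import Level using (0ℓ)
open import Axiom.ExcludedMiddle using (ExcludedMiddle)

module WeakestRely (E S : Set) where
  open UTP E S

  drop-length-++ : ∀ (a b : Trace) → drop (length a) (a ++ b) ≡ b
  drop-length-++ []      b = refl
  drop-length-++ (_ ∷ a) b = drop-length-++ a b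

  ≼-trans : ∀ {a b c : Trace} → a ≼ b → b ≼ c → a ≼ c
  ≼-trans {a} (z₁ , refl) (z₂ , refl) = z₁ ++ z₂ , ++-assoc a z₁ z₂

  drop-mono-≼ : ∀ n {a b : Trace} → a ≼ b → drop n a ≼ drop n b
  drop-mono-≼ zero    p            = p
  drop-mono-≼ (suc n) {[]}    {b} _ = drop (suc n) b , refl
  drop-mono-≼ (suc n) {_ ∷ a} (z , refl) = drop-mono-≼ n {a} (z , refl)

  ++-≼-drop : ∀ {a b t : Trace} → a ≼ b → t ≼ drop (length a) b → (a ++ t) ≼ b
  ++-≼-drop {a} (y , refl) (z , eq) =
    z , trans (cong (a ++_) (trans (sym (drop-length-++ a y)) eq)) (sym (++-assoc a _ z))

  ttr-mono : ∀ v v' w → tr v' ≼ tr w → ttr v v' ≼ ttr v w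
  ttr-mono v _ _ = drop-mono-≼ (length (tr v))

  𝓘-intro : ∀ s t v v' → tr v ≼ tr v' →
            ¬ s (st v) ⊎ ¬ t (st v) ≼ ttr v v' → 𝓘 s t v v'
  𝓘-intro s t v v' p h =
    ref v , (v' , (false , false , false , false ,
                   inj₁ (p , map (λ ns → ns , _ , refl) (λ nt → nt , _ , refl) h) , p) ,
             [] , sym (++-identityʳ (tr v'))) , p

  𝓘-elim : ∀ s t v v' → 𝓘 s t v v' →
           tr v ≼ tr v' × (¬ s (st v) ⊎ ¬ t (st v) ≼ ttr v v')
  𝓘-elim s t v v' (_ , (_ , (_ , _ , _ , _ , inj₁ (_ , inj₁ (ns , _)) , _) , _) , p) = p , inj₁ ns
  -- The RC witness w extends tr', so t ≼ tt would give t ≼ tr w - tr.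
  𝓘-elim s t v v' (_ , (w , (_ , _ , _ , _ , inj₁ (_ , inj₂ (nt , _)) , _) , q) , p) =
    p , inj₂ λ t≼ → nt (≼-trans t≼ (ttr-mono v v' w q))
  𝓘-elim s t v v' (_ , (_ , (_ , _ , _ , _ , inj₂ (np , _) , p₁) , _) , _) = ⊥-elim (np p₁)

  module _ (lem : ExcludedMiddle 0ℓ) (s : S → Set) (t : S → Trace) (v v' : Obs) where

    𝓘-introᶜ : tr v ≼ tr v' → (s (st v) → ¬ t (st v) ≼ ttr v v') → 𝓘 s t v v'
    𝓘-introᶜ p h with lem {s (st v)}
    ... | yes a  = 𝓘-intro s t v v' p (inj₂ (h a))
    ... | no ¬a = 𝓘-intro s t v v' p (inj₁ ¬a)

    ¬𝓘-elim : tr v ≼ tr v' → ¬ 𝓘 s t v v' → s (st v) × t (st v) ≼ ttr v v'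
    ¬𝓘-elim p ¬i with lem {s (st v)} | lem {t (st v) ≼ ttr v v'}
    ... | yes a  | yes b  = a , b
    ... | no ¬a | _      = ⊥-elim (¬i (𝓘-intro s t v v' p (inj₁ ¬a)))
    ... | _      | no ¬b = ⊥-elim (¬i (𝓘-intro s t v v' p (inj₂ ¬b)))

  N-I-intro : ∀ cs v v₀ v₁ {u₀ u₁} → ttr v v₀ ≡ u₀ → ttr v v₁ ≡ u₁ →
              ∀ {u} → u ∈ u₀ ∥[ cs ] u₁ → u₀ ↾ cs ≡ u₁ ↾ cs →
              N-I cs v v₀ v₁ (record v { tr = tr v ++ u ; ref = λ _ → false })
  N-I-intro cs v v₀ v₁ refl refl {u} m e =
    subst (λ x → x ∈ _ ∥[ cs ] _) (sym (drop-length-++ (tr v) u)) m , e , (λ _ ()) , refl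

  N-I-traces : ∀ cs v v₀ v₁ w {u₀ u₁} → ttr v v₀ ≡ u₀ → ttr v v₁ ≡ u₁ →
               N-I cs v v₀ v₁ w → ttr v w ∈ u₀ ∥[ cs ] u₁ × u₀ ↾ cs ≡ u₁ ↾ cs
  N-I-traces cs v v₀ v₁ w refl refl (m , e , _) = m , e

  record Prescribes (s : S → Set) (t : S → Trace) (P : Rel) : Set where
    field
      sound    : ∀ {v v'} → P v v' → s (st v) × ttr v v' ≡ t (st v)
      feasible : ∀ {v} → s (st v) → Σ Obs (P v)

  open Prescribes

  Φ-prescribes : ∀ s σ t → Prescribes s t (Φ s σ t)
  Φ-prescribes s σ t .sound (_ , _ , _ , _ , _ , inj₁ (_ , a , _ , eq) , _) = a , eq
  Φ-prescribes s σ t .sound (_ , _ , _ , _ , _ , inj₂ (np , _) , p) = ⊥-elim (np p)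
  Φ-prescribes s σ t .feasible {v} a =
    record v { tr = tr v ++ t (st v) ; st = σ (st v) } ,
    ref v , false , false , false , false ,
    inj₁ ((t (st v) , refl) , a , refl , drop-length-++ (tr v) (t (st v))) , (t (st v) , refl)

  𝓔-prescribes : ∀ s t A → Prescribes s t (𝓔 s t A)
  𝓔-prescribes s t A .sound (_ , _ , _ , _ , _ , inj₁ (_ , a , eq , _) , _) = a , eq
  𝓔-prescribes s t A .sound (_ , _ , _ , _ , _ , inj₂ (np , _) , p) = ⊥-elim (np p)
  𝓔-prescribes s t A .feasible {v} a =
    record v { tr = tr v ++ t (st v) ; ref = λ _ → false } ,
    ref v , false , false , false , false ,
    inj₁ ((t (st v) , refl) , a , drop-length-++ (tr v) (t (st v)) , λ _ _ ()) , (t (st v) , refl)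

  module _ (lem : ExcludedMiddle 0ℓ) (cs : ESet) {s₁ s₂ : S → Set} {t₁ t₂ : S → Trace}
           {P : Rel} (P-prescribes : Prescribes s₁ t₁ P) where

    merge-condition : Trace → Trace → S → Set
    merge-condition tt₀ tt₁ σ = s₁ σ × s₂ σ × (tt₁ ∈ (t₂ σ ++ tt₀) ∥[ cs ] t₁ σ)
                              × ((t₂ σ ++ tt₀) ↾ cs ≡ t₁ σ ↾ cs)

    wr-𝓘⇒rhs43 : ∀ v v' → (P wr[ cs ] 𝓘 s₂ t₂) v v' → rhs43 cs s₁ s₂ t₁ t₂ v v'
    wr-𝓘⇒rhs43 v v' (¬par , p) tt₀ tt₁ =
      𝓘-introᶜ lem (merge-condition tt₀ tt₁) (λ _ → tt₁) v v' p λ (a , b , m , e) tt₁≼ →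
      let v₁ , q = P-prescribes .feasible a
          v₀ : Obs
          v₀ = record v { tr = tr v ++ (t₂ (st v) ++ tt₀) }
          tt₀-of-v₀ : ttr v v₀ ≡ t₂ (st v) ++ tt₀
          tt₀-of-v₀ = drop-length-++ (tr v) (t₂ (st v) ++ tt₀)
          ¬𝓘-v₀ : ¬ 𝓘 s₂ t₂ v v₀
          ¬𝓘-v₀ i = [ (λ ¬b → ¬b b) , (λ ¬t → ¬t (tt₀ , tt₀-of-v₀)) ]′
                      (proj₂ (𝓘-elim s₂ t₂ v v₀ i))
          w : Obs
          w = record v { tr = tr v ++ tt₁ ; ref = λ _ → false }
      in ¬par (v₀ , v₁ , (¬𝓘-v₀ , t₂ (st v) ++ tt₀ , refl) , q ,
               w , N-I-intro cs v v₀ v₁ tt₀-of-v₀ (proj₂ (P-prescribes .sound q)) m e ,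
               _ , ++-≼-drop p tt₁≼)

    rhs43⇒wr-𝓘 : ∀ v v' → rhs43 cs s₁ s₂ t₁ t₂ v v' → (P wr[ cs ] 𝓘 s₂ t₂) v v'
    rhs43⇒wr-𝓘 v v' R = ¬par , proj₁ (𝓘-elim (merge-condition [] []) (λ _ → []) v v' (R [] []))
      where
      ¬par : ¬ ((¬r 𝓘 s₂ t₂) ∥[ N-I cs ⨾ᵐ true-r ]ᵐ P) v v'
      ¬par (v₀ , v₁ , (¬i , p₀) , q , w , nI , _ , pw) =
        let b , (u , tt₀-of-v₀) = ¬𝓘-elim lem s₂ t₂ v v₀ p₀ ¬i
            a , tt₁-of-v₁       = P-prescribes .sound q
            m , e               = N-I-traces cs v v₀ v₁ w tt₀-of-v₀ tt₁-of-v₁ nI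
        in [ (λ ¬s → ¬s (a , b , m , e)) , (λ ¬t → ¬t (ttr-mono v w v' pw)) ]′
             (proj₂ (𝓘-elim (merge-condition u (ttr v w)) (λ _ → ttr v w) v v' (R u (ttr v w))))

    wr-𝓘≈rhs43 : (P wr[ cs ] 𝓘 s₂ t₂) ≈ᵣ rhs43 cs s₁ s₂ t₁ t₂
    wr-𝓘≈rhs43 v v' = wr-𝓘⇒rhs43 v v' , rhs43⇒wr-𝓘 v v'

theorem43 : ExcludedMiddle 0ℓ →
    (E S : Set) (cs : E → Bool) (s₁ s₂ : S → Set) (t₁ t₂ : S → List E)
    (A : S → E → Bool) (σ₁ : S → S) →
    let open UTP E S in
    ((Φ s₁ σ₁ t₁ wr[ cs ] 𝓘 s₂ t₂) ≈ᵣ rhs43 cs s₁ s₂ t₁ t₂)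
    × ((𝓔 s₁ t₁ A wr[ cs ] 𝓘 s₂ t₂) ≈ᵣ rhs43 cs s₁ s₂ t₁ t₂)
theorem43 lem E S cs s₁ s₂ t₁ t₂ A σ₁ =
  wr-𝓘≈rhs43 lem cs (Φ-prescribes s₁ σ₁ t₁) , wr-𝓘≈rhs43 lem cs (𝓔-prescribes s₁ t₁ A)
  where open WeakestRely E S
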